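{- Let $G$ be a finite simple graph with $\alpha(G)=2$, let $uv$ be a dominating edge of $G$, and let $W$ be the set of vertices of $G$ adjacent to both $u$ and $v$. Then there exist cliques $C^1,\dots,C^\ell$ of the induced subgraph $G[W]$ with $C^1\cup\dots\cup C^\ell=W$ and $\ell\leq \lceil \frac{|W|+1}{2}\rceil$.
   Context: $\alpha(G)$ is the independence number. An edge $uv$ is dominating if every vertex of $G$ other than $u,v$ is adjacent to at least one of $u,v$. A clique is a set of pairwise adjacent vertices. -}

module Defs where

open import Data.Nat using (ℕ; _≤_; ⌈_/2⌉; _+_)
open import Data.Fin using (Fin)
open import Data.Fin.Subset using (Subset; _∈_; _⊆_; ∣_∣; ⋃)
open import Data.Bool using (Bool; true; false; _∧_)
open import Data.Vec using (tabulate)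
open import Data.List using (List; length)
open import Data.List.Relation.Unary.All using (All)
open import Data.Product using (Σ; _×_; ∃)
open import Data.Sum using (_⊎_)
open import Relation.Binary.PropositionalEquality using (_≡_; _≢_)
open import Relation.Nullary using (¬_)

record Graph (n : ℕ) : Set where
  field
    adj     : Fin n → Fin n → Bool
    sym     : ∀ x y → adj x y ≡ adj y x
    irrefl  : ∀ x → adj x x ≡ false

open Graph public

Adj : {n : ℕ} → Graph n → Fin n → Fin n → Set
Adj G x y = adj G x y ≡ true

IsIndependent : {n : ℕ} → Graph n → Subset n → Set
IsIndependent G S = ∀ x y → x ∈ S → y ∈ S → ¬ Adj G x y

IsClique : {n : ℕ} → Graph n → Subset n → Set
IsClique G S = ∀ x y → x ∈ S → y ∈ S → x ≢ y → Adj G x y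

IndependenceNumber : {n : ℕ} → Graph n → ℕ → Set
IndependenceNumber G k =
  (Σ (Subset _) λ S → IsIndependent G S × ∣ S ∣ ≡ k)
  × (∀ S → IsIndependent G S → ∣ S ∣ ≤ k)

IsDominatingEdge : {n : ℕ} → Graph n → Fin n → Fin n → Set
IsDominatingEdge G u v =
  Adj G u v × (∀ w → w ≢ u → w ≢ v → Adj G u w ⊎ Adj G v w)

CommonNbhd : {n : ℕ} → Graph n → Fin n → Fin n → Subset n
CommonNbhd G u v = tabulate λ w → adj G u w ∧ adj G v w

IsCliqueOfInduced : {n : ℕ} → Graph n → Subset n → Subset n → Set
IsCliqueOfInduced G W C = C ⊆ W × IsClique G C

{-# OPTIONS --safe #-}
-- Greedily take an edge xy inside S as
-- one clique and recurse on S - x - y, which costs one clique per two vertices.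
-- If instead some x ∈ S has no neighbour in S, then S - x is a clique, since a
-- non-edge ab in S - x would make {x, a, b} independent; the two cliques {x}
-- and S - x suffice as soon as |S| ≥ 2.
module Submission where

open import Defs hiding (sym)
open import Data.Nat using (ℕ; suc; _≤_; _<_; _+_; ⌈_/2⌉; z≤n; s≤s)
open import Data.Nat.Properties
  using (≤-trans; ≤-refl; _≤?_; ≰⇒>; ⌈n/2⌉-mono; +-monoˡ-≤; m≤n+m; n≤1+n; ≤-reflexive)
open import Data.Nat.Induction using (<-wellFounded)
open import Data.Fin using (Fin; _≟_)
open import Data.Fin.Properties using (any?)
open import Data.Fin.Subset
  using (Subset; ∣_∣; ⋃; _∈_; _∉_; _⊆_; _∪_; _─_; _-_; ⁅_⁆; Nonempty; outside)
open import Data.Fin.Subset.Properties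
  using ( _∈?_; x∈⁅x⁆; x∈⁅y⁆⇒x≡y; x∈p∪q⁺; x∈p∪q⁻; q⊆p∪q; ∪-assoc; ∪-identityʳ
        ; ⊆-antisym; p─q⊆p; x∈p∧x≢y⇒x∈p-y; x∈p⇒∣p-x∣<∣p∣
        ; nonempty?; Empty-unique; ∣⊥∣≡0; ∣⁅x⁆∣≡1 )
open import Data.List using (List; length; []; _∷_)
open import Data.List.Relation.Unary.All using (All; []; _∷_)
import Data.List.Relation.Unary.All as All
open import Data.Product using (Σ; _×_; _,_)
open import Data.Sum using (_⊎_; inj₁; inj₂)
open import Data.Empty using (⊥; ⊥-elim)
open import Data.Bool using (true)
import Data.Bool.Properties as Bool
open import Data.Vec using (_∷_)
open import Data.Vec.Base using (here; there)
open import Function using (_∘_; id)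
open import Induction.WellFounded using (module All)
import Relation.Binary.Construct.On as On
open import Relation.Nullary using (¬_; Dec; yes; no; contradiction)
open import Relation.Nullary.Decidable using (_×-dec_)
open import Relation.Binary.PropositionalEquality
  using (_≡_; _≢_; refl; sym; trans; subst; cong; ≢-sym; module ≡-Reasoning)

private
  variable
    n : ℕ

x∈p─q⇒x∉q : ∀ (p q : Subset n) {x} → x ∈ p ─ q → x ∉ q
x∈p─q⇒x∉q (_ ∷ p) (outside ∷ q) here      ()
x∈p─q⇒x∉q (_ ∷ p) (_       ∷ q) (there a) (there b) = x∈p─q⇒x∉q p q a b

x∈p-y⇒x≢y : ∀ {p : Subset n} {x y} → x ∈ p - y → x ≢ y
x∈p-y⇒x≢y {p = p} {y = y} x∈p-y refl = x∈p─q⇒x∉q p ⁅ y ⁆ x∈p-y (x∈⁅x⁆ y)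

x∈p-y⇒x∈p : ∀ {p : Subset n} {x y} → x ∈ p - y → x ∈ p
x∈p-y⇒x∈p {p = p} {y = y} = p─q⊆p p ⁅ y ⁆

x∈⁅y⁆∪⁅z⁆⇒x≡y⊎x≡z : ∀ {x y z : Fin n} → x ∈ ⁅ y ⁆ ∪ ⁅ z ⁆ → x ≡ y ⊎ x ≡ z
x∈⁅y⁆∪⁅z⁆⇒x≡y⊎x≡z {y = y} {z} x∈ with x∈p∪q⁻ ⁅ y ⁆ ⁅ z ⁆ x∈
... | inj₁ x∈⁅y⁆ = inj₁ (x∈⁅y⁆⇒x≡y y x∈⁅y⁆)
... | inj₂ x∈⁅z⁆ = inj₂ (x∈⁅y⁆⇒x≡y z x∈⁅z⁆)

x∈⁅y⁆∪⁅z⁆∪⁅w⁆⇒x≡y⊎x≡z⊎x≡w : ∀ {x y z w : Fin n} → x ∈ ⁅ y ⁆ ∪ ⁅ z ⁆ ∪ ⁅ w ⁆ →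
                  x ≡ y ⊎ x ≡ z ⊎ x ≡ w
x∈⁅y⁆∪⁅z⁆∪⁅w⁆⇒x≡y⊎x≡z⊎x≡w {y = y} {z} {w} x∈ with x∈p∪q⁻ ⁅ y ⁆ (⁅ z ⁆ ∪ ⁅ w ⁆) x∈
... | inj₁ x∈⁅y⁆ = inj₁ (x∈⁅y⁆⇒x≡y y x∈⁅y⁆)
... | inj₂ x∈⁅z⁆∪⁅w⁆ = inj₂ (x∈⁅y⁆∪⁅z⁆⇒x≡y⊎x≡z x∈⁅z⁆∪⁅w⁆)

x∈p⇒⁅x⁆∪p-x≡p : ∀ {p : Subset n} {x} → x ∈ p → ⁅ x ⁆ ∪ (p - x) ≡ p
x∈p⇒⁅x⁆∪p-x≡p {p = p} {x} x∈p = ⊆-antisym ⊆p p⊆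
  where
  ⊆p : ⁅ x ⁆ ∪ (p - x) ⊆ p
  ⊆p a∈ with x∈p∪q⁻ ⁅ x ⁆ (p - x) a∈
  ... | inj₁ a∈⁅x⁆ rewrite x∈⁅y⁆⇒x≡y x a∈⁅x⁆ = x∈p
  ... | inj₂ a∈p-x = x∈p-y⇒x∈p a∈p-x
  p⊆ : p ⊆ ⁅ x ⁆ ∪ (p - x)
  p⊆ {a} a∈p with a ≟ x
  ... | yes refl = x∈p∪q⁺ (inj₁ (x∈⁅x⁆ a))
  ... | no a≢x   = x∈p∪q⁺ (inj₂ (x∈p∧x≢y⇒x∈p-y a∈p a≢x))

⁅x⁆∪⁅y⁆∪p-x-y≡p : ∀ {p : Subset n} {x y} → x ∈ p → y ∈ p → x ≢ y →
                  (⁅ x ⁆ ∪ ⁅ y ⁆) ∪ (p - x - y) ≡ p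
⁅x⁆∪⁅y⁆∪p-x-y≡p {p = p} {x} {y} x∈p y∈p x≢y = begin
  (⁅ x ⁆ ∪ ⁅ y ⁆) ∪ (p - x - y)  ≡⟨ ∪-assoc ⁅ x ⁆ ⁅ y ⁆ (p - x - y) ⟩
  ⁅ x ⁆ ∪ (⁅ y ⁆ ∪ (p - x - y))  ≡⟨ cong (⁅ x ⁆ ∪_) (x∈p⇒⁅x⁆∪p-x≡p y∈p-x) ⟩
  ⁅ x ⁆ ∪ (p - x)                ≡⟨ x∈p⇒⁅x⁆∪p-x≡p x∈p ⟩
  p                              ∎
  where
  open ≡-Reasoning
  y∈p-x : y ∈ p - x
  y∈p-x = x∈p∧x≢y⇒x∈p-y y∈p (≢-sym x≢y)

∣p-x-y∣+2≤∣p∣ : ∀ {p : Subset n} {x y} → x ∈ p → y ∈ p → x ≢ y →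
                suc (suc ∣ p - x - y ∣) ≤ ∣ p ∣
∣p-x-y∣+2≤∣p∣ x∈p y∈p x≢y =
  ≤-trans (s≤s (x∈p⇒∣p-x∣<∣p∣ (x∈p∧x≢y⇒x∈p-y y∈p (≢-sym x≢y)))) (x∈p⇒∣p-x∣<∣p∣ x∈p)

x,y∈p⇒2≤∣p∣ : ∀ {p : Subset n} {x y} → x ∈ p → y ∈ p → x ≢ y → 2 ≤ ∣ p ∣
x,y∈p⇒2≤∣p∣ x∈p y∈p x≢y = ≤-trans (s≤s (s≤s z≤n)) (∣p-x-y∣+2≤∣p∣ x∈p y∈p x≢y)

3≤∣⁅x⁆∪⁅y⁆∪⁅z⁆∣ : ∀ {x y z : Fin n} → x ≢ y → x ≢ z → y ≢ z →
                  3 ≤ ∣ ⁅ x ⁆ ∪ ⁅ y ⁆ ∪ ⁅ z ⁆ ∣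
3≤∣⁅x⁆∪⁅y⁆∪⁅z⁆∣ {x = x} {y} {z} x≢y x≢z y≢z =
  ≤-trans (s≤s (x,y∈p⇒2≤∣p∣ (x∈p∧x≢y⇒x∈p-y y∈ (≢-sym x≢y))
                            (x∈p∧x≢y⇒x∈p-y z∈ (≢-sym x≢z)) y≢z))
          (x∈p⇒∣p-x∣<∣p∣ x∈)
  where
  x∈ : x ∈ ⁅ x ⁆ ∪ ⁅ y ⁆ ∪ ⁅ z ⁆
  x∈ = x∈p∪q⁺ (inj₁ (x∈⁅x⁆ x))
  y∈ : y ∈ ⁅ x ⁆ ∪ ⁅ y ⁆ ∪ ⁅ z ⁆
  y∈ = x∈p∪q⁺ (inj₂ (x∈p∪q⁺ (inj₁ (x∈⁅x⁆ y))))
  z∈ : z ∈ ⁅ x ⁆ ∪ ⁅ y ⁆ ∪ ⁅ z ⁆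
  z∈ = x∈p∪q⁺ (inj₂ (x∈p∪q⁺ (inj₂ (x∈⁅x⁆ z))))

1≤∣p∣⇒Nonempty : ∀ {p : Subset n} → 1 ≤ ∣ p ∣ → Nonempty p
1≤∣p∣⇒Nonempty {n} {p} 1≤∣p∣ with nonempty? p
... | yes p≢∅ = p≢∅
... | no  p≡∅ = contradiction (subst (1 ≤_) ∣p∣≡0 1≤∣p∣) λ ()
  where
  ∣p∣≡0 : ∣ p ∣ ≡ 0
  ∣p∣≡0 = trans (cong ∣_∣ (Empty-unique p≡∅)) (∣⊥∣≡0 n)

∣p∣≤1⇒IsClique : (G : Graph n) {p : Subset n} → ∣ p ∣ ≤ 1 → IsClique G p
∣p∣≤1⇒IsClique G ∣p∣≤1 x y x∈p y∈p x≢y with ≤-trans (x,y∈p⇒2≤∣p∣ x∈p y∈p x≢y) ∣p∣≤1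
... | s≤s ()

module _ (G : Graph n) where

  Adj? : ∀ x y → Dec (Adj G x y)
  Adj? x y = adj G x y Bool.≟ true

  Adj-sym : ∀ {x y} → Adj G x y → Adj G y x
  Adj-sym {x} {y} x~y = trans (Graph.sym G y x) x~y

  Adj⇒≢ : ∀ {x y} → Adj G x y → x ≢ y
  Adj⇒≢ {x} x~x refl with trans (sym x~x) (irrefl G x)
  ... | ()

  ¬Adj-irrefl : ∀ x → ¬ Adj G x x
  ¬Adj-irrefl x x~x = Adj⇒≢ x~x refl

  IsClique-⁅x⁆∪⁅y⁆ : ∀ {x y} → Adj G x y → IsClique G (⁅ x ⁆ ∪ ⁅ y ⁆)
  IsClique-⁅x⁆∪⁅y⁆ x~y a b a∈ b∈ a≢b
    with x∈⁅y⁆∪⁅z⁆⇒x≡y⊎x≡z a∈ | x∈⁅y⁆∪⁅z⁆⇒x≡y⊎x≡z b∈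
  ... | inj₁ refl | inj₁ refl = contradiction refl a≢b
  ... | inj₁ refl | inj₂ refl = x~y
  ... | inj₂ refl | inj₁ refl = Adj-sym x~y
  ... | inj₂ refl | inj₂ refl = contradiction refl a≢b

  IsIndependent-⁅x⁆∪⁅y⁆∪⁅z⁆ : ∀ {x y z} → ¬ Adj G x y → ¬ Adj G x z → ¬ Adj G y z →
                              IsIndependent G (⁅ x ⁆ ∪ ⁅ y ⁆ ∪ ⁅ z ⁆)
  IsIndependent-⁅x⁆∪⁅y⁆∪⁅z⁆ x≁y x≁z y≁z a b a∈ b∈
    with x∈⁅y⁆∪⁅z⁆∪⁅w⁆⇒x≡y⊎x≡z⊎x≡w a∈ | x∈⁅y⁆∪⁅z⁆∪⁅w⁆⇒x≡y⊎x≡z⊎x≡w b∈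
  ... | inj₁ refl        | inj₁ refl        = ¬Adj-irrefl a
  ... | inj₁ refl        | inj₂ (inj₁ refl) = x≁y
  ... | inj₁ refl        | inj₂ (inj₂ refl) = x≁z
  ... | inj₂ (inj₁ refl) | inj₁ refl        = x≁y ∘ Adj-sym
  ... | inj₂ (inj₁ refl) | inj₂ (inj₁ refl) = ¬Adj-irrefl a
  ... | inj₂ (inj₁ refl) | inj₂ (inj₂ refl) = y≁z
  ... | inj₂ (inj₂ refl) | inj₁ refl        = x≁z ∘ Adj-sym
  ... | inj₂ (inj₂ refl) | inj₂ (inj₁ refl) = y≁z ∘ Adj-sym
  ... | inj₂ (inj₂ refl) | inj₂ (inj₂ refl) = ¬Adj-irrefl a

  CliqueCover : Subset n → ℕ → Set
  CliqueCover S m = Σ (List (Subset n)) λ Cs →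
    All (IsCliqueOfInduced G S) Cs × ⋃ Cs ≡ S × length Cs ≤ m

  cover-mono : ∀ {S m m′} → m ≤ m′ → CliqueCover S m → CliqueCover S m′
  cover-mono m≤m′ (Cs , cliques , ⋃Cs≡S , ∣Cs∣≤m) = Cs , cliques , ⋃Cs≡S , ≤-trans ∣Cs∣≤m m≤m′

  cover-clique : ∀ {C} → IsClique G C → CliqueCover C 1
  cover-clique {C} C-clique = C ∷ [] , (id , C-clique) ∷ [] , ∪-identityʳ C , ≤-refl

  cover-∪ : ∀ {C T m} → IsClique G C → CliqueCover T m → CliqueCover (C ∪ T) (suc m)
  cover-∪ {C} {T} C-clique (Cs , cliques , ⋃Cs≡T , ∣Cs∣≤m) =
    C ∷ Cs , (x∈p∪q⁺ ∘ inj₁ , C-clique) ∷ All.map weaken cliques ,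
    cong (C ∪_) ⋃Cs≡T , s≤s ∣Cs∣≤m
    where
    weaken : ∀ {D} → IsCliqueOfInduced G T D → IsCliqueOfInduced G (C ∪ T) D
    weaken (D⊆T , D-clique) = q⊆p∪q C T ∘ D⊆T , D-clique

  ShortCliqueCover : Subset n → Set
  ShortCliqueCover S = CliqueCover S ⌈ ∣ S ∣ + 1 /2⌉

  module _ (α≤2 : ∀ S → IsIndependent G S → ∣ S ∣ ≤ 2) where

    no-independent-triple : ∀ {x y z} → x ≢ y → x ≢ z → y ≢ z →
                            ¬ Adj G x y → ¬ Adj G x z → ¬ Adj G y z → ⊥
    no-independent-triple x≢y x≢z y≢z x≁y x≁z y≁z with
      ≤-trans (3≤∣⁅x⁆∪⁅y⁆∪⁅z⁆∣ x≢y x≢z y≢z) (α≤2 _ (IsIndependent-⁅x⁆∪⁅y⁆∪⁅z⁆ x≁y x≁z y≁z))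
    ... | s≤s (s≤s ())

    nonNeighbours-isClique : ∀ {S x} → (∀ {y} → y ∈ S → ¬ Adj G x y) → IsClique G (S - x)
    nonNeighbours-isClique x≁S a b a∈ b∈ a≢b with Adj? a b
    ... | yes a~b = a~b
    ... | no  a≁b = ⊥-elim (no-independent-triple
                             (≢-sym (x∈p-y⇒x≢y a∈)) (≢-sym (x∈p-y⇒x≢y b∈)) a≢b
                             (x≁S (x∈p-y⇒x∈p a∈)) (x≁S (x∈p-y⇒x∈p b∈)) a≁b)

    short-cover-step : ∀ S → (∀ {T} → ∣ T ∣ < ∣ S ∣ → ShortCliqueCover T) → ShortCliqueCover S
    short-cover-step S short-cover<S with ∣ S ∣ ≤? 1
    ... | yes ∣S∣≤1 =
      cover-mono (⌈n/2⌉-mono (m≤n+m 1 ∣ S ∣)) (cover-clique (∣p∣≤1⇒IsClique G ∣S∣≤1))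
    ... | no ∣S∣≰1 with 1≤∣p∣⇒Nonempty (≤-trans (s≤s z≤n) (≰⇒> ∣S∣≰1))
    ... | x , x∈S with any? (λ y → y ∈? S ×-dec Adj? x y)
    ... | yes (y , y∈S , x~y) =
      -- ⌈ (2 + t) + 1 /2⌉ reduces to suc ⌈ t + 1 /2⌉.
      cover-mono (⌈n/2⌉-mono (+-monoˡ-≤ 1 ∣T∣+2≤∣S∣))
        (subst (λ P → CliqueCover P (suc ⌈ ∣ S - x - y ∣ + 1 /2⌉)) S≡xy∪T
          (cover-∪ (IsClique-⁅x⁆∪⁅y⁆ x~y) (short-cover<S (≤-trans (n≤1+n _) ∣T∣+2≤∣S∣))))
      where
      ∣T∣+2≤∣S∣ = ∣p-x-y∣+2≤∣p∣ x∈S y∈S (Adj⇒≢ x~y)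
      S≡xy∪T = ⁅x⁆∪⁅y⁆∪p-x-y≡p x∈S y∈S (Adj⇒≢ x~y)
    ... | no x≁S =
      cover-mono (⌈n/2⌉-mono (+-monoˡ-≤ 1 (≰⇒> ∣S∣≰1)))
        (subst (λ P → CliqueCover P 2) (x∈p⇒⁅x⁆∪p-x≡p x∈S)
          (cover-∪ (∣p∣≤1⇒IsClique G (≤-reflexive (∣⁅x⁆∣≡1 x)))
            (cover-clique (nonNeighbours-isClique λ y∈S x~y → x≁S (_ , y∈S , x~y)))))

    short-cover : ∀ S → ShortCliqueCover S
    short-cover = All.wfRec (On.wellFounded ∣_∣ <-wellFounded) _ ShortCliqueCover short-cover-step

lemma12 : {n : ℕ} (G : Graph n) (u v : Fin n) →
    IndependenceNumber G 2 →
    IsDominatingEdge G u v →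
    Σ (List (Subset n)) λ Cs →
      All (IsCliqueOfInduced G (CommonNbhd G u v)) Cs
      × ⋃ Cs ≡ CommonNbhd G u v
      × length Cs ≤ ⌈ ∣ CommonNbhd G u v ∣ + 1 /2⌉
lemma12 G u v (_ , α≤2) _ = short-cover G α≤2 (CommonNbhd G u v)
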